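{- The $2$-stratified $\mathcal{L}_{cl}$-sentence $$\phi:\ \forall X\exists Y\big(\forall z(\mathcal{S}(z)\Rightarrow(z\in Y\iff z\notin X))\land(\mathcal{S}(X)\lor\mathcal{S}(Y))\big),$$ in which $X,Y$ range over all elements, is independent of $\mathrm{BAC}$ (neither $\phi$ nor $\neg\phi$ is provable in $\mathrm{BAC}$).
   Context: $\mathcal{L}_{cl}$ is the language with binary $\in$ and unary $\mathcal{S}$; elements satisfying $\mathcal{S}$ are sets, all elements are classes. A formula is $2$-stratified if there is a map $\sigma$ from its variables to $\{0,1\}$ with $\sigma(y)=\sigma(x)+1$ whenever $x\in y$ is a subformula and $\sigma(y)=\sigma(x)$ whenever $x=y$ is a subformula. $\mathrm{BAC}$ has axioms (lowercase variables over sets, uppercase over classes): (Mem) if $X\in Y$ then $X$ is a set; (Subset) if $x$ is a set and every set in $X$ is in $x$ then $X$ is a set; (Emp) there is a set with no set members; (Adj) for sets $x,y$ there is a set whose set members are exactly those of $x$ together with $y$; (CExt) classes with the same set members are equal; (Union) for sets $x,y$ there is a set whose set members are those in $x$ or $y$; (UB) for every set $x$ there is a set $y\notin x$; (CUnion),(CIntersection) for classes $X,Y$ there are classes whose set members are those in $X$ or $Y$, resp. in both; (CComp) every class $X$ has a class whose set members are exactly the sets not in $X$. -}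

module Defs where

open import Data.Product using (Σ; ∃; _×_; _,_)
open import Data.Sum using (_⊎_)
open import Relation.Nullary using (¬_)
open import Relation.Binary.PropositionalEquality using (_≡_)
open import Function.Bundles using (_⇔_)

-- An L_cl-structure: a domain of "classes" (all elements), a binary
-- membership relation and a unary predicate S ("is a set").
-- Equality of the object language is interpreted as Agda's _≡_.
record Structure : Set₁ where
  field
    Carrier : Set
    _∈_     : Carrier → Carrier → Set
    S       : Carrier → Set

module _ (M : Structure) where
  open Structure M

  -- Lowercase variables range over sets (elements with S), uppercase over
  -- all elements (classes).

  Mem : Set
  Mem = ∀ X Y → X ∈ Y → S X

  SubsetAx : Set
  SubsetAx = ∀ x X → S x → (∀ z → S z → z ∈ X → z ∈ x) → S X

  Emp : Set
  Emp = Σ Carrier λ x → S x × (∀ z → S z → ¬ (z ∈ x))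

  Adj : Set
  Adj = ∀ x y → S x → S y →
        Σ Carrier λ w → S w × (∀ z → S z → (z ∈ w ⇔ (z ∈ x ⊎ z ≡ y)))

  CExt : Set
  CExt = ∀ X Y → (∀ z → S z → (z ∈ X ⇔ z ∈ Y)) → X ≡ Y

  Union : Set
  Union = ∀ x y → S x → S y →
          Σ Carrier λ w → S w × (∀ z → S z → (z ∈ w ⇔ (z ∈ x ⊎ z ∈ y)))

  UB : Set
  UB = ∀ x → S x → Σ Carrier λ y → S y × ¬ (y ∈ x)

  CUnion : Set
  CUnion = ∀ X Y → Σ Carrier λ Z → ∀ z → S z → (z ∈ Z ⇔ (z ∈ X ⊎ z ∈ Y))

  CIntersection : Set
  CIntersection = ∀ X Y → Σ Carrier λ Z → ∀ z → S z → (z ∈ Z ⇔ (z ∈ X × z ∈ Y))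

  CComp : Set
  CComp = ∀ X → Σ Carrier λ Z → ∀ z → S z → (z ∈ Z ⇔ (¬ (z ∈ X)))

  record IsBAC : Set where
    field
      mem           : Mem
      subset        : SubsetAx
      emp           : Emp
      adj           : Adj
      cext          : CExt
      union         : Union
      ub            : UB
      cunion        : CUnion
      cintersection : CIntersection
      ccomp         : CComp

  φ : Set
  φ = ∀ X → Σ Carrier λ Y →
        (∀ z → S z → (z ∈ Y ⇔ (¬ (z ∈ X)))) × (S X ⊎ S Y)

-- Independence of φ from BAC, stated semantically: there is a model of
-- BAC in which φ holds and a model of BAC in which ¬φ holds.
IndependentOfBAC : (Structure → Set) → Set₁
IndependentOfBAC ψ =
  (Σ Structure λ M → IsBAC M × ψ M) × (Σ Structure λ N → IsBAC N × ¬ ψ N)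

-- Sets are the hereditarily finite sets in Ackermann's coding (k ∈ n iff bit k
-- of n is 1), classes are collections of them, only sets are members, and the
-- sets are exactly the finite classes.  Any Boolean algebra of such collections
-- containing the finite ones is then a model of BAC, and φ holds in it exactly
-- when every class or its complement is finite.  The finite–cofinite classes
-- therefore satisfy φ, while among the eventually 2-periodic classes the even
-- numbers and their complement, the odd numbers, are both proper classes.
module Submission where

open import Defs
open import Data.Bool using (Bool; true; false; not; _∨_; _∧_; _xor_; T; if_then_else_)
open import Data.Bool.Properties
  using (not-injective; xor-identityʳ; xor-same; xor-assoc; not-distribˡ-xor; T-≡; T-∨; T-∧; ⇔→≡)
open import Data.Nat using (ℕ; zero; suc; _+_; _≤_; z≤n; s≤s; _≡ᵇ_; ⌊_/2⌋)
open import Data.Nat.Properties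
  using (≤-refl; ≤-pred; ≤-<-trans; m≤m+n; m≤n+m; m≤n⇒m≤1+n; m+n≤o⇒m≤o; m+n≤o⇒n≤o;
         +-suc; >⇒≢; _≟_; ≡ᵇ⇒≡; ≡⇒≡ᵇ; ⌊n/2⌋-mono; ⌊n/2⌋<n)
open import Data.Product using (Σ; ∃; _×_; _,_; proj₁; proj₂; uncurry)
open import Data.Product.Function.NonDependent.Propositional using (_×-⇔_)
open import Data.Sum using (_⊎_; inj₁; inj₂)
open import Data.Sum.Function.Propositional using (_⊎-⇔_)
open import Data.Unit using (tt)
open import Data.Empty using (⊥-elim)
open import Function using (_∘_; const; id)
open import Function.Bundles using (_⇔_; mk⇔; Equivalence)
open import Function.Construct.Identity using (⇔-id)
open import Function.Properties.Equivalence using () renaming (trans to ⇔-trans; sym to ⇔-sym)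
open import Function.Related.TypeIsomorphisms using (¬-cong-⇔)
open import Relation.Nullary using (¬_)
open import Relation.Nullary.Decidable using (dec-false)
open import Relation.Binary.PropositionalEquality
  using (_≡_; refl; sym; trans; cong; cong₂; subst; module ≡-Reasoning)

open Equivalence using (to; from)
open ≡-Reasoning

AgreeFrom : ℕ → (ℕ → Bool) → (ℕ → Bool) → Set
AgreeFrom N f g = ∀ k → N ≤ k → f k ≡ g k

T-cong : ∀ {a b} → a ≡ b → T a ⇔ T b
T-cong refl = mk⇔ id id

T-injective : ∀ {a b} → T a ⇔ T b → a ≡ b
T-injective a⇔b = ⇔→≡ (⇔-trans (⇔-sym T-≡) (⇔-trans a⇔b T-≡))

T-not : ∀ {a} → T (not a) ⇔ (¬ T a)
T-not {false} = mk⇔ (λ _ ()) (λ _ → tt)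
T-not {true}  = mk⇔ (λ ()) (λ ¬t → ¬t tt)

xor-cancelˡ-≡ : ∀ a {b c} → a xor b ≡ a xor c → b ≡ c
xor-cancelˡ-≡ false eq = eq
xor-cancelˡ-≡ true  eq = not-injective eq

xor-involutive : ∀ a b → a xor (a xor b) ≡ b
xor-involutive a b = trans (sym (xor-assoc a a b)) (cong (_xor b) (xor-same a))

lsb : ℕ → Bool
lsb zero          = false
lsb (suc zero)    = true
lsb (suc (suc n)) = lsb n

bit : ℕ → ℕ → Bool
bit n zero    = lsb n
bit n (suc k) = bit ⌊ n /2⌋ k

infixr 5 _∷ᵇ_

_∷ᵇ_ : Bool → ℕ → ℕ
b ∷ᵇ zero  = if b then 1 else 0
b ∷ᵇ suc q = suc (suc (b ∷ᵇ q))

lsb-∷ᵇ : ∀ b q → lsb (b ∷ᵇ q) ≡ b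
lsb-∷ᵇ false zero    = refl
lsb-∷ᵇ true  zero    = refl
lsb-∷ᵇ b     (suc q) = lsb-∷ᵇ b q

⌊∷ᵇ/2⌋ : ∀ b q → ⌊ b ∷ᵇ q /2⌋ ≡ q
⌊∷ᵇ/2⌋ false zero    = refl
⌊∷ᵇ/2⌋ true  zero    = refl
⌊∷ᵇ/2⌋ b     (suc q) = cong suc (⌊∷ᵇ/2⌋ b q)

lsb∷ᵇ⌊/2⌋ : ∀ n → lsb n ∷ᵇ ⌊ n /2⌋ ≡ n
lsb∷ᵇ⌊/2⌋ zero          = refl
lsb∷ᵇ⌊/2⌋ (suc zero)    = refl
lsb∷ᵇ⌊/2⌋ (suc (suc n)) = cong (suc ∘ suc) (lsb∷ᵇ⌊/2⌋ n)

n≤1+k⇒⌊n/2⌋≤k : ∀ {n k} → n ≤ suc k → ⌊ n /2⌋ ≤ k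
n≤1+k⇒⌊n/2⌋≤k {k = k} n≤1+k = ≤-pred (≤-<-trans (⌊n/2⌋-mono n≤1+k) (⌊n/2⌋<n k))

bit-≥ : ∀ {n k} → n ≤ k → bit n k ≡ false
bit-≥ {k = zero}  z≤n    = refl
bit-≥ {k = suc k} n≤1+k = bit-≥ (n≤1+k⇒⌊n/2⌋≤k n≤1+k)

bit-injective : ∀ {m n} → (∀ k → bit m k ≡ bit n k) → m ≡ n
bit-injective {m} {n} = go (m + n) (m≤m+n m n) (m≤n+m n m)
  where
  go : ∀ bound {m n} → m ≤ bound → n ≤ bound → (∀ k → bit m k ≡ bit n k) → m ≡ n
  go zero        z≤n  z≤n  _    = refl
  go (suc bound) {m} {n} m≤ n≤ same = begin
    m                ≡⟨ lsb∷ᵇ⌊/2⌋ m ⟨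
    lsb m ∷ᵇ ⌊ m /2⌋ ≡⟨ cong₂ _∷ᵇ_ (same 0) (go bound (n≤1+k⇒⌊n/2⌋≤k m≤) (n≤1+k⇒⌊n/2⌋≤k n≤)
                                                   (same ∘ suc)) ⟩
    lsb n ∷ᵇ ⌊ n /2⌋ ≡⟨ lsb∷ᵇ⌊/2⌋ n ⟩
    n                ∎

encode : ℕ → (ℕ → Bool) → ℕ
encode zero    f = 0
encode (suc N) f = f 0 ∷ᵇ encode N (f ∘ suc)

bit-encode : ∀ N f → AgreeFrom N f (const false) → ∀ k → bit (encode N f) k ≡ f k
bit-encode zero    f vanishes k       = trans (bit-≥ {k = k} z≤n) (sym (vanishes k z≤n))
bit-encode (suc N) f vanishes zero    = lsb-∷ᵇ (f 0) (encode N (f ∘ suc))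
bit-encode (suc N) f vanishes (suc k) =
  trans (cong (λ n → bit n k) (⌊∷ᵇ/2⌋ (f 0) _))
        (bit-encode N (f ∘ suc) (λ k → vanishes (suc k) ∘ s≤s) k)

-- A class is coded by a pattern it follows from some point on, together with
-- the finite set on which it differs from it.  Recovering the pattern from any
-- tail makes this code unique, so class extensionality becomes equality.
-- ∅-or-infinite is the constructive content of the Subset axiom: a class
-- following a nonempty pattern has members beyond every set.
record PatternAlgebra : Set₁ where
  field
    Pattern        : Set
    ⟦_⟧            : Pattern → ℕ → Bool
    ∅              : Pattern
    ∁              : Pattern → Pattern
    zipWith        : (Bool → Bool → Bool) → Pattern → Pattern → Pattern
    ⟦∅⟧            : ∀ k → ⟦ ∅ ⟧ k ≡ false
    ⟦∁⟧            : ∀ p k → ⟦ ∁ p ⟧ k ≡ not (⟦ p ⟧ k)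
    ⟦zipWith⟧      : ∀ f p q k → ⟦ zipWith f p q ⟧ k ≡ f (⟦ p ⟧ k) (⟦ q ⟧ k)
    tail-injective : ∀ N {p q} → AgreeFrom N ⟦ p ⟧ ⟦ q ⟧ → p ≡ q
    ∅-or-infinite  : ∀ p → p ≡ ∅ ⊎ (∀ N → ∃ λ k → N ≤ k × ⟦ p ⟧ k ≡ true)

module Model (A : PatternAlgebra) where
  open PatternAlgebra A

  Class : Set
  Class = Pattern × ℕ

  χ : Class → ℕ → Bool
  χ (p , n) k = ⟦ p ⟧ k xor bit n k

  IsSet : Class → Set
  IsSet (p , _) = p ≡ ∅

  _∈_ : Class → Class → Set
  (p , m) ∈ X = p ≡ ∅ × T (χ X m)

  structure : Structure
  structure = record { Carrier = Class ; _∈_ = _∈_ ; S = IsSet }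

  set : ℕ → Class
  set n = ∅ , n

  ∀-set : {P : Class → Set} → (∀ n → P (set n)) → ∀ z → IsSet z → P z
  ∀-set P-set (_ , n) refl = P-set n

  set-∈ : ∀ {k X} → T (χ X k) ⇔ set k ∈ X
  set-∈ = mk⇔ (refl ,_) proj₂

  ∈-from-χ : ∀ {Z} {P : Class → Set} → (∀ k → T (χ Z k) ⇔ P (set k)) →
             ∀ z → IsSet z → (z ∈ Z ⇔ P z)
  ∈-from-χ spec = ∀-set λ k → ⇔-trans (⇔-sym set-∈) (spec k)

  χ-from : ∀ p n → AgreeFrom n (χ (p , n)) ⟦ p ⟧
  χ-from p n k n≤k = trans (cong (⟦ p ⟧ k xor_) (bit-≥ n≤k)) (xor-identityʳ _)

  χ-set-≥ : ∀ {m k} → m ≤ k → χ (set m) k ≡ false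
  χ-set-≥ {m} {k} m≤k = trans (χ-from ∅ m k m≤k) (⟦∅⟧ k)

  set-∉ : ∀ {m k} → m ≤ k → ¬ set k ∈ set m
  set-∉ m≤k (_ , k∈m) = subst T (χ-set-≥ m≤k) k∈m

  χ-injective : ∀ {X Y} → (∀ k → χ X k ≡ χ Y k) → X ≡ Y
  χ-injective {p , m} {q , n} same with tail-injective (m + n) agree
    where
    agree : AgreeFrom (m + n) ⟦ p ⟧ ⟦ q ⟧
    agree k m+n≤k = begin
      ⟦ p ⟧ k     ≡⟨ χ-from p m k (m+n≤o⇒m≤o m m+n≤k) ⟨
      χ (p , m) k ≡⟨ same k ⟩
      χ (q , n) k ≡⟨ χ-from q n k (m+n≤o⇒n≤o m m+n≤k) ⟩
      ⟦ q ⟧ k     ∎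
  ... | refl = cong (p ,_) (bit-injective λ k → xor-cancelˡ-≡ (⟦ p ⟧ k) (same k))

  realise : ∀ p N f → AgreeFrom N f ⟦ p ⟧ → Σ ℕ λ n → ∀ k → χ (p , n) k ≡ f k
  realise p N f agree = encode N δ , λ k → begin
      ⟦ p ⟧ k xor bit (encode N δ) k ≡⟨ cong (⟦ p ⟧ k xor_) (bit-encode N δ δ-vanishes k) ⟩
      ⟦ p ⟧ k xor (⟦ p ⟧ k xor f k)  ≡⟨ xor-involutive (⟦ p ⟧ k) (f k) ⟩
      f k                            ∎
    where
    δ : ℕ → Bool
    δ k = ⟦ p ⟧ k xor f k
    δ-vanishes : AgreeFrom N δ (const false)
    δ-vanishes k N≤k = trans (cong (⟦ p ⟧ k xor_) (agree k N≤k)) (xor-same (⟦ p ⟧ k))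

  realise-set : ∀ N f → AgreeFrom N f (const false) → Σ ℕ λ n → ∀ k → χ (set n) k ≡ f k
  realise-set N f vanishes = realise ∅ N f λ k N≤k → trans (vanishes k N≤k) (sym (⟦∅⟧ k))

  pointwise : (f : Bool → Bool → Bool) (X Y : Class) →
              Σ Class λ Z → ∀ k → χ Z k ≡ f (χ X k) (χ Y k)
  pointwise f X@(p , m) Y@(q , n) = (zipWith f p q , proj₁ Z) , proj₂ Z
    where
    Z : Σ ℕ λ r → ∀ k → χ (zipWith f p q , r) k ≡ f (χ X k) (χ Y k)
    Z = realise (zipWith f p q) (m + n) (λ k → f (χ X k) (χ Y k)) λ k m+n≤k →
          trans (cong₂ f (χ-from p m k (m+n≤o⇒m≤o m m+n≤k)) (χ-from q n k (m+n≤o⇒n≤o m m+n≤k)))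
                (sym (⟦zipWith⟧ f p q k))

  ∈-∪ : ∀ {X Y Z} → (∀ k → χ Z k ≡ χ X k ∨ χ Y k) →
        ∀ z → IsSet z → (z ∈ Z ⇔ (z ∈ X ⊎ z ∈ Y))
  ∈-∪ χ-Z = ∈-from-χ λ k → ⇔-trans (T-cong (χ-Z k)) (⇔-trans T-∨ (set-∈ ⊎-⇔ set-∈))

  ∈-∩ : ∀ {X Y Z} → (∀ k → χ Z k ≡ χ X k ∧ χ Y k) →
        ∀ z → IsSet z → (z ∈ Z ⇔ (z ∈ X × z ∈ Y))
  ∈-∩ χ-Z = ∈-from-χ λ k → ⇔-trans (T-cong (χ-Z k)) (⇔-trans T-∧ (set-∈ ×-⇔ set-∈))

  complement : Class → Class
  complement (p , n) = ∁ p , n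

  χ-complement : ∀ X k → χ (complement X) k ≡ not (χ X k)
  χ-complement (p , n) k = begin
    ⟦ ∁ p ⟧ k xor bit n k     ≡⟨ cong (_xor bit n k) (⟦∁⟧ p k) ⟩
    not (⟦ p ⟧ k) xor bit n k ≡⟨ not-distribˡ-xor (⟦ p ⟧ k) (bit n k) ⟨
    not (⟦ p ⟧ k xor bit n k) ∎

  ∈-complement : ∀ X z → IsSet z → (z ∈ complement X ⇔ (¬ z ∈ X))
  ∈-complement X = ∈-from-χ λ k →
    ⇔-trans (T-cong (χ-complement X k)) (⇔-trans T-not (¬-cong-⇔ set-∈))

  singleton : ∀ b → Σ Class λ s → IsSet s × (∀ z → IsSet z → (z ∈ s ⇔ z ≡ set b))
  singleton b = set (proj₁ s) , refl , ∈-from-χ λ k →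
    ⇔-trans (T-cong (proj₂ s k)) (mk⇔ (cong set ∘ ≡ᵇ⇒≡ k b) (≡⇒≡ᵇ k b ∘ cong proj₂))
    where
    s : Σ ℕ λ n → ∀ k → χ (set n) k ≡ (k ≡ᵇ b)
    s = realise-set (suc b) (_≡ᵇ b) λ k b<k → dec-false (k ≟ b) (>⇒≢ b<k)

  union : Union structure
  union (_ , a) (_ , b) refl refl = set (proj₁ u) , refl , ∈-∪ (proj₂ u)
    where
    u : Σ ℕ λ n → ∀ k → χ (set n) k ≡ χ (set a) k ∨ χ (set b) k
    u = realise-set (a + b) (λ k → χ (set a) k ∨ χ (set b) k) λ k a+b≤k →
          cong₂ _∨_ (χ-set-≥ (m+n≤o⇒m≤o a a+b≤k)) (χ-set-≥ (m+n≤o⇒n≤o a a+b≤k))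

  adj : Adj structure
  adj x (_ , b) x-set refl with singleton b
  ... | s , s-set , ∈s with union x s x-set s-set
  ... | w , w-set , ∈w =
    w , w-set , λ z z-set → ⇔-trans (∈w z z-set) (⇔-id _ ⊎-⇔ ∈s z z-set)

  subset : SubsetAx structure
  subset (_ , m) (p , n) refl X⊆x with ∅-or-infinite p
  ... | inj₁ p≡∅      = p≡∅
  ... | inj₂ infinite with infinite (m + n)
  ...   | k , m+n≤k , ⟦p⟧k =
    ⊥-elim (set-∉ (m+n≤o⇒m≤o m m+n≤k) (X⊆x (set k) refl (to set-∈ (subst T (sym χ-k) tt))))
    where
    χ-k : χ (p , n) k ≡ true
    χ-k = trans (χ-from p n k (m+n≤o⇒n≤o m m+n≤k)) ⟦p⟧k

  cext : CExt structure
  cext X Y same = χ-injective λ k →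
    T-injective (⇔-trans set-∈ (⇔-trans (same (set k) refl) (⇔-sym set-∈)))

  isBAC : IsBAC structure
  isBAC = record
    { mem           = λ _ _ → proj₁
    ; subset        = subset
    ; emp           = set 0 , refl , ∀-set λ _ → set-∉ z≤n
    ; adj           = adj
    ; cext          = cext
    ; union         = union
    ; ub            = ∀-set λ m → set m , refl , set-∉ ≤-refl
    ; cunion        = λ X Y → let Z , χ-Z = pointwise _∨_ X Y in Z , ∈-∪ χ-Z
    ; cintersection = λ X Y → let Z , χ-Z = pointwise _∧_ X Y in Z , ∈-∩ χ-Z
    ; ccomp         = λ X → complement X , ∈-complement X
    }

  φ⇔complemented : φ structure ⇔ (∀ p → p ≡ ∅ ⊎ ∁ p ≡ ∅)
  φ⇔complemented = mk⇔ complemented φ-holds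
    where
    φ-holds : (∀ p → p ≡ ∅ ⊎ ∁ p ≡ ∅) → φ structure
    φ-holds dichotomy X@(p , _) = complement X , ∈-complement X , dichotomy p

    complemented : φ structure → ∀ p → p ≡ ∅ ⊎ ∁ p ≡ ∅
    complemented Φ p with Φ (p , 0)
    ... | _ , _    , inj₁ p≡∅   = inj₁ p≡∅
    ... | Y , ∈Y , inj₂ Y-set = inj₂ (trans (cong proj₁ (sym Y≡∁X)) Y-set)
      where
      Y≡∁X : Y ≡ complement (p , 0)
      Y≡∁X = cext Y (complement (p , 0)) λ z z-set →
               ⇔-trans (∈Y z z-set) (⇔-sym (∈-complement (p , 0) z z-set))

constantPatterns : PatternAlgebra
constantPatterns = record
  { Pattern        = Bool
  ; ⟦_⟧            = λ b _ → b
  ; ∅              = false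
  ; ∁              = not
  ; zipWith        = id
  ; ⟦∅⟧            = λ _ → refl
  ; ⟦∁⟧            = λ _ _ → refl
  ; ⟦zipWith⟧      = λ _ _ _ _ → refl
  ; tail-injective = λ N agree → agree N ≤-refl
  ; ∅-or-infinite  = λ { false → inj₁ refl ; true → inj₂ λ N → N , ≤-refl , refl }
  }

alternate : Bool → Bool → ℕ → Bool
alternate a b zero    = a
alternate a b (suc k) = alternate b a k

alternate-even : ∀ a b n → alternate a b (n + n) ≡ a
alternate-even a b zero = refl
alternate-even a b (suc n) rewrite +-suc n n = alternate-even a b n

alternate-odd : ∀ a b n → alternate a b (suc (n + n)) ≡ b
alternate-odd a b = alternate-even b a

alternate-const : ∀ a k → alternate a a k ≡ a
alternate-const a zero    = refl
alternate-const a (suc k) = alternate-const a k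

alternate-not : ∀ a b k → alternate (not a) (not b) k ≡ not (alternate a b k)
alternate-not a b zero    = refl
alternate-not a b (suc k) = alternate-not b a k

alternate-zipWith : ∀ (f : Bool → Bool → Bool) a b c d k →
                     alternate (f a c) (f b d) k ≡ f (alternate a b k) (alternate c d k)
alternate-zipWith f a b c d zero    = refl
alternate-zipWith f a b c d (suc k) = alternate-zipWith f b a d c k

alternate-tail-injective : ∀ N {p q} → AgreeFrom N (uncurry alternate p) (uncurry alternate q) → p ≡ q
alternate-tail-injective N {a , b} {c , d} agree = cong₂ _,_
  (begin
    a                     ≡⟨ alternate-even a b N ⟨
    alternate a b (N + N) ≡⟨ agree (N + N) (m≤m+n N N) ⟩
    alternate c d (N + N) ≡⟨ alternate-even c d N ⟩
    c                     ∎)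
  (begin
    b                           ≡⟨ alternate-odd a b N ⟨
    alternate a b (suc (N + N)) ≡⟨ agree (suc (N + N)) (m≤n⇒m≤1+n (m≤m+n N N)) ⟩
    alternate c d (suc (N + N)) ≡⟨ alternate-odd c d N ⟩
    d                           ∎)

alternatingPatterns : PatternAlgebra
alternatingPatterns = record
  { Pattern        = Bool × Bool
  ; ⟦_⟧            = uncurry alternate
  ; ∅              = false , false
  ; ∁              = λ (a , b) → not a , not b
  ; zipWith        = λ f (a , b) (c , d) → f a c , f b d
  ; ⟦∅⟧            = alternate-const false
  ; ⟦∁⟧            = λ (a , b) → alternate-not a b
  ; ⟦zipWith⟧      = λ f (a , b) (c , d) → alternate-zipWith f a b c d
  ; tail-injective = alternate-tail-injective
  ; ∅-or-infinite  = λ where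
      (false , false) → inj₁ refl
      (true  , b)     → inj₂ λ N → N + N , m≤m+n N N , alternate-even true b N
      (false , true)  → inj₂ λ N → suc (N + N) , m≤n⇒m≤1+n (m≤m+n N N) , alternate-odd false true N
  }

module FiniteCofinite = Model constantPatterns
module EventuallyPeriodic = Model alternatingPatterns

mainTheorem16 : IndependentOfBAC φ
mainTheorem16 =
    (FiniteCofinite.structure , FiniteCofinite.isBAC ,
     from FiniteCofinite.φ⇔complemented λ { false → inj₁ refl ; true → inj₂ refl })
  , (EventuallyPeriodic.structure , EventuallyPeriodic.isBAC ,
     λ Φ → evens-not-complemented (to EventuallyPeriodic.φ⇔complemented Φ (true , false)))
  where
  evens-not-complemented : ¬ ((true , false) ≡ (false , false) ⊎ (false , true) ≡ (false , false))
  evens-not-complemented (inj₁ ())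
  evens-not-complemented (inj₂ ())
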